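{- Define $A_1=1$ and $A_{k+1}=1+A_k^2$ for $k\ge 1$. For all $m\ge1$ and $k\ge1$, the number of win-loss sequences for an $m$-card game that end within $k$ passthroughs (i.e. corresponding to an $m$-card $k$-passthrough game) is $A_k^m$.
   Context: A win-loss sequence for an $m$-card game is a finite string $x_1\cdots x_R$ over $\{W,L\}$ such that, writing $w_i,\ell_i$ for the numbers of $W$'s and $L$'s among $x_1,\dots,x_i$, one has $m+w_i-\ell_i>0$ for $1\le i<R$ and $m+w_R-\ell_R=0$ (it records, from Alice's point of view, the outcomes of the rounds of a game of War in which Alice starts with $m$ cards and eventually loses; $W$ adds one card to Alice's hand and $L$ removes one). The sequence is split into passthroughs of Alice's hand: the first passthrough consists of the first $m$ letters, and each subsequent passthrough consists of the next $2t$ letters, where $t$ is the number of $W$'s in the previous passthrough; the sequence ends exactly at the end of a passthrough. The sequence ends within $k$ passthroughs if it consists of at most $k$ passthroughs. -}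

module Defs where

open import Data.Nat using (ℕ; zero; suc; _+_; _*_; _≤_; _<_)
open import Data.List using (List; []; _∷_; _++_; length; take)
open import Data.Product using (_×_)
open import Relation.Binary.PropositionalEquality using (_≡_)

-- outcome of a round, from Alice's point of view
data Res : Set where
  W L : Res

wins : List Res → ℕ
wins []       = 0
wins (W ∷ xs) = suc (wins xs)
wins (L ∷ xs) = wins xs

losses : List Res → ℕ
losses []       = 0
losses (W ∷ xs) = losses xs
losses (L ∷ xs) = suc (losses xs)

IsWinLoss : ℕ → List Res → Set
IsWinLoss m xs =
  (∀ i → 1 ≤ i → i < length xs → losses (take i xs) < m + wins (take i xs))
  × (m + wins xs ≡ losses xs)

-- SplitWithin k n xs : xs splits into at most k consecutive passthroughs,
-- the first of length n, each following one of length 2t where t is the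
-- number of W's in the previous passthrough, xs ending exactly at the end
-- of a passthrough.
data SplitWithin : ℕ → ℕ → List Res → Set where
  last : ∀ {k n} (ys : List Res) → length ys ≡ n → SplitWithin (suc k) n ys
  step : ∀ {k n} (ys zs : List Res) → length ys ≡ n →
         SplitWithin k (2 * wins ys) zs → SplitWithin (suc k) n (ys ++ zs)

KGame : ℕ → ℕ → List Res → Set
KGame m k xs = IsWinLoss m xs × SplitWithin k m xs

-- A_1 = 1, A_{k+1} = 1 + A_k^2 ; A k for k ≥ 1 (A 0 is an unused dummy value)
A : ℕ → ℕ
A zero          = 1
A (suc zero)    = 1
A (suc (suc k)) = 1 + A (suc k) * A (suc k)

{-# OPTIONS --safe #-}
-- After a passthrough of n letters with w wins, Alice, who began it with n cards, holds
-- exactly 2w cards, whatever the order of the letters, and her hand cannot run out in the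
-- middle of a passthrough.  So a game within k + 1 passthroughs from n cards is a free
-- string ys of length n followed by a game within k passthroughs from 2 · wins ys cards.
-- If the latter number is c_k(j) = a^j, then summing over ys gives
-- c_{k+1}(n) = Σ_w C(n, w) a^(2w) = (1 + a²)^n, which is the recursion defining A.
module Submission where

open import Defs
open import Data.Nat using (ℕ; zero; suc; _^_; _≤_; _<_; _+_; _*_; z≤n; s≤s)
open import Data.Nat.Properties using (+-suc; +-identityʳ; *-identityˡ; *-suc; ≤-pred; suc-injective)
open import Data.Nat.Tactic.RingSolver using (solve-∀)
open import Data.List using (List; length; []; _∷_; _++_; map; take; [_])
open import Data.List.Properties using (length-map; length-++; ++-identityʳ; ∷-injectiveʳ)
open import Data.List.Membership.Propositional using (_∈_)
open import Data.List.Membership.Propositional.Properties using (∈-map⁺; ∈-map⁻; ∈-++⁺ˡ; ∈-++⁺ʳ; ∈-++⁻)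
open import Data.List.Relation.Unary.Any using (here)
open import Data.List.Relation.Unary.All using ([])
open import Data.List.Relation.Unary.Unique.Propositional using (Unique; []; _∷_)
open import Data.List.Relation.Unary.Unique.Propositional.Properties using (++⁺; map⁺)
open import Data.Product using (Σ; _×_; _,_; ∃₂)
open import Data.Sum using (inj₁; inj₂)
open import Data.Empty using (⊥)
open import Relation.Binary.PropositionalEquality using (_≡_; refl; sym; trans; cong; cong₂; subst; module ≡-Reasoning)

private
  variable
    h m n : ℕ
    xs zs : List Res
    f : ℕ → List (List Res)

data Exhausts : ℕ → List Res → Set where
  done : Exhausts 0 []
  won  : Exhausts (suc (suc h)) xs → Exhausts (suc h) (W ∷ xs)
  lost : Exhausts h xs → Exhausts (suc h) (L ∷ xs)

exhausts⇒positive : Exhausts h xs →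
                    ∀ i → i < length xs → losses (take i xs) < h + wins (take i xs)
exhausts⇒positive (won e)  zero    _         = s≤s z≤n
exhausts⇒positive (lost e) zero    _         = s≤s z≤n
exhausts⇒positive (won {h} {xs} e) (suc i) (s≤s i<) =
  subst (losses (take i xs) <_) (sym (+-suc (suc h) _)) (exhausts⇒positive e i i<)
exhausts⇒positive (lost e) (suc i) (s≤s i<) = s≤s (exhausts⇒positive e i i<)

exhausts⇒balanced : Exhausts h xs → h + wins xs ≡ losses xs
exhausts⇒balanced done           = refl
exhausts⇒balanced (won {h} {xs} e) = trans (+-suc (suc h) (wins xs)) (exhausts⇒balanced e)
exhausts⇒balanced (lost e)       = cong suc (exhausts⇒balanced e)

positive⇒exhausts : (∀ i → i < length xs → losses (take i xs) < h + wins (take i xs)) →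
                    h + wins xs ≡ losses xs → Exhausts h xs
positive⇒exhausts {[]}     {zero}  _   _  = done
positive⇒exhausts {[]}     {suc h} _   ()
positive⇒exhausts {_ ∷ _}  {zero}  pos _  with pos 0 (s≤s z≤n)
... | ()
positive⇒exhausts {W ∷ xs} {suc h} pos balanced =
  won (positive⇒exhausts
        (λ i i< → subst (losses (take i xs) <_) (+-suc (suc h) _) (pos (suc i) (s≤s i<)))
        (trans (sym (+-suc (suc h) (wins xs))) balanced))
positive⇒exhausts {L ∷ xs} {suc h} pos balanced =
  lost (positive⇒exhausts (λ i i< → ≤-pred (pos (suc i) (s≤s i<))) (suc-injective balanced))

exhausts⇒isWinLoss : Exhausts m xs → IsWinLoss m xs
exhausts⇒isWinLoss e = (λ i _ → exhausts⇒positive e i) , exhausts⇒balanced e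

isWinLoss⇒exhausts : 1 ≤ m → IsWinLoss m xs → Exhausts m xs
isWinLoss⇒exhausts {suc m} {xs} _ (pos , balanced) = positive⇒exhausts pos′ balanced
  where
  pos′ : ∀ i → i < length xs → losses (take i xs) < suc m + wins (take i xs)
  pos′ zero    _ = s≤s z≤n
  pos′ (suc i)   = pos (suc i) (s≤s z≤n)

private
  plus-two : ∀ l c → l + (2 + c) ≡ 2 + (l + c)
  plus-two = solve-∀

  double-suc : ∀ w c → 2 * suc w + c ≡ 2 * w + (2 + c)
  double-suc = solve-∀

exhausts-++⁺ : ∀ ys {c zs} → Exhausts (2 * wins ys + c) zs → Exhausts (length ys + c) (ys ++ zs)
exhausts-++⁺ []       e = e
exhausts-++⁺ (L ∷ ys) e = lost (exhausts-++⁺ ys e)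
exhausts-++⁺ (W ∷ ys) {c} {zs} e =
  won (subst (λ n → Exhausts n (ys ++ zs)) (plus-two (length ys) c)
        (exhausts-++⁺ ys (subst (λ n → Exhausts n zs) (double-suc (wins ys) c) e)))

exhausts-++⁻ : ∀ ys {c zs} → Exhausts (length ys + c) (ys ++ zs) → Exhausts (2 * wins ys + c) zs
exhausts-++⁻ []       e        = e
exhausts-++⁻ (L ∷ ys) (lost e) = exhausts-++⁻ ys e
exhausts-++⁻ (W ∷ ys) {c} {zs} (won e) =
  subst (λ n → Exhausts n zs) (sym (double-suc (wins ys) c))
    (exhausts-++⁻ ys (subst (λ n → Exhausts n (ys ++ zs)) (sym (plus-two (length ys) c)) e))

exhausts-passthrough⁺ : ∀ ys {zs} → Exhausts (2 * wins ys) zs → Exhausts (length ys) (ys ++ zs)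
exhausts-passthrough⁺ ys {zs} e =
  subst (λ n → Exhausts n (ys ++ zs)) (+-identityʳ (length ys))
    (exhausts-++⁺ ys (subst (λ n → Exhausts n zs) (sym (+-identityʳ _)) e))

exhausts-passthrough⁻ : ∀ ys {zs} → Exhausts (length ys) (ys ++ zs) → Exhausts (2 * wins ys) zs
exhausts-passthrough⁻ ys {zs} e =
  subst (λ n → Exhausts n zs) (+-identityʳ _)
    (exhausts-++⁻ ys (subst (λ n → Exhausts n (ys ++ zs)) (sym (+-identityʳ (length ys))) e))

passthrough : (ℕ → List (List Res)) → ℕ → List (List Res)
passthrough f zero    = f 0
passthrough f (suc n) = map (W ∷_) (passthrough (λ j → f (2 + j)) n) ++ map (L ∷_) (passthrough f n)

∈-passthrough⁻ : ∀ n → xs ∈ passthrough f n →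
                 ∃₂ λ ys zs → length ys ≡ n × xs ≡ ys ++ zs × zs ∈ f (2 * wins ys)
∈-passthrough⁻ zero    p = [] , _ , refl , refl , p
∈-passthrough⁻ {f = f} (suc n) p with ∈-++⁻ (map (W ∷_) (passthrough (λ j → f (2 + j)) n)) p
... | inj₁ p′ with ∈-map⁻ (W ∷_) p′
...   | _ , q , refl with ∈-passthrough⁻ n q
...     | ys , zs , refl , refl , r =
          W ∷ ys , zs , refl , refl , subst (λ j → zs ∈ f j) (sym (*-suc 2 (wins ys))) r
∈-passthrough⁻ (suc n) p | inj₂ p′ with ∈-map⁻ (L ∷_) p′
...   | _ , q , refl with ∈-passthrough⁻ n q
...     | ys , zs , refl , refl , r = L ∷ ys , zs , refl , refl , r

∈-passthrough⁺ : ∀ ys → zs ∈ f (2 * wins ys) → ys ++ zs ∈ passthrough f (length ys)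
∈-passthrough⁺ []       p = p
∈-passthrough⁺ {zs} {f} (W ∷ ys) p =
  ∈-++⁺ˡ (∈-map⁺ (W ∷_) (∈-passthrough⁺ ys (subst (λ j → zs ∈ f j) (*-suc 2 (wins ys)) p)))
∈-passthrough⁺ {f = f} (L ∷ ys) p =
  ∈-++⁺ʳ (map (W ∷_) (passthrough (λ j → f (2 + j)) (length ys))) (∈-map⁺ (L ∷_) (∈-passthrough⁺ ys p))

passthrough-unique : (∀ j → Unique (f j)) → ∀ n → Unique (passthrough f n)
passthrough-unique u zero    = u 0
passthrough-unique u (suc n) =
  ++⁺ (map⁺ ∷-injectiveʳ (passthrough-unique (λ j → u (2 + j)) n))
      (map⁺ ∷-injectiveʳ (passthrough-unique u n))
      λ (p , q) → W≢L p q
  where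
  W≢L : ∀ {xs ys : List (List Res)} {v} → v ∈ map (W ∷_) xs → v ∈ map (L ∷_) ys → ⊥
  W≢L p q with ∈-map⁻ (W ∷_) p | ∈-map⁻ (L ∷_) q
  ... | _ , _ , refl | _ , _ , ()

length-passthrough : ∀ b c → (∀ j → length (f j) ≡ c * b ^ j) →
                     ∀ n → length (passthrough f n) ≡ c * (1 + b * b) ^ n
length-passthrough b c len zero = len 0
length-passthrough {f} b c len (suc n) = begin
  length (map (W ∷_) (passthrough f₂ n) ++ map (L ∷_) (passthrough f n))
    ≡⟨ length-++ (map (W ∷_) (passthrough f₂ n)) ⟩
  length (map (W ∷_) (passthrough f₂ n)) + length (map (L ∷_) (passthrough f n))
    ≡⟨ cong₂ _+_ (length-map _ (passthrough f₂ n)) (length-map _ (passthrough f n)) ⟩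
  length (passthrough f₂ n) + length (passthrough f n)
    ≡⟨ cong₂ _+_ (length-passthrough b (c * (b * b)) len₂ n) (length-passthrough b c len n) ⟩
  c * (b * b) * q + c * q
    ≡⟨ factor c (b * b) q ⟩
  c * ((1 + b * b) * q) ∎
  where
  open ≡-Reasoning
  q = (1 + b * b) ^ n
  f₂ = λ j → f (2 + j)
  len₂ : ∀ j → length (f₂ j) ≡ c * (b * b) * b ^ j
  len₂ j = trans (len (2 + j)) (reassoc c b (b ^ j))
    where
    reassoc : ∀ c b x → c * (b * (b * x)) ≡ c * (b * b) * x
    reassoc = solve-∀
  factor : ∀ c s q → c * s * q + c * q ≡ c * ((1 + s) * q)
  factor = solve-∀

-- games 0 0 contains the empty game, although SplitWithin 0 is empty.
games : ℕ → ℕ → List (List Res)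
games zero    zero    = [ [] ]
games zero    (suc _) = []
games (suc k) n       = passthrough (games k) n

games-unique : ∀ k n → Unique (games k n)
games-unique zero    zero    = [] ∷ []
games-unique zero    (suc _) = []
games-unique (suc k) n       = passthrough-unique (games-unique k) n

length-games₀ : ∀ n → length (games 0 n) ≡ 1 * 0 ^ n
length-games₀ zero    = refl
length-games₀ (suc n) = refl

length-games : ∀ k n → length (games (suc k) n) ≡ A (suc k) ^ n
length-games zero    n = trans (length-passthrough 0 1 length-games₀ n) (*-identityˡ _)
length-games (suc k) n = trans (length-passthrough (A (suc k)) 1 length-games′ n) (*-identityˡ _)
  where
  length-games′ : ∀ j → length (games (suc k) j) ≡ 1 * A (suc k) ^ j
  length-games′ j = trans (length-games k j) (sym (*-identityˡ _))

games⇒exhausts : ∀ k → xs ∈ games k n → Exhausts n xs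
games⇒exhausts {n = zero} zero (here refl) = done
games⇒exhausts {n = n} (suc k) p with ∈-passthrough⁻ n p
... | ys , zs , refl , refl , q = exhausts-passthrough⁺ ys (games⇒exhausts k q)

games₀-empty : ∀ n → xs ∈ games 0 n → xs ≡ []
games₀-empty zero (here refl) = refl

games⇒splitWithin : ∀ k → xs ∈ games (suc k) n → SplitWithin (suc k) n xs
games⇒splitWithin {n = n} k p with ∈-passthrough⁻ n p
games⇒splitWithin zero    p | ys , zs , refl , refl , q with games₀-empty (2 * wins ys) q
... | refl = subst (SplitWithin 1 (length ys)) (sym (++-identityʳ ys)) (last ys refl)
games⇒splitWithin (suc k) p | ys , zs , refl , refl , q = step ys zs refl (games⇒splitWithin k q)

[]∈games : ∀ k → Exhausts n [] → [] ∈ games k n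
[]∈games zero    done = here refl
[]∈games (suc k) done = []∈games k done

splitWithin⇒games : ∀ {k} → Exhausts n xs → SplitWithin k n xs → xs ∈ games k n
splitWithin⇒games {k = suc k} e (last ys refl) =
  subst (_∈ games (suc k) (length ys)) (++-identityʳ ys)
    (∈-passthrough⁺ ys ([]∈games k (exhausts-passthrough⁻ ys e′)))
  where
  e′ : Exhausts (length ys) (ys ++ [])
  e′ = subst (Exhausts (length ys)) (sym (++-identityʳ ys)) e
splitWithin⇒games e (step ys zs refl s) =
  ∈-passthrough⁺ ys (splitWithin⇒games (exhausts-passthrough⁻ ys e) s)

theorem4p3 : (m k : ℕ) → 1 ≤ m → 1 ≤ k →
    Σ (List (List Res)) (λ S →
      Unique S
      × ((xs : List Res) → xs ∈ S → KGame m k xs)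
      × ((xs : List Res) → KGame m k xs → xs ∈ S)
      × length S ≡ A k ^ m)
theorem4p3 m (suc k) m≥1 _ =
  games (suc k) m ,
  games-unique (suc k) m ,
  (λ xs p → exhausts⇒isWinLoss (games⇒exhausts (suc k) p) , games⇒splitWithin k p) ,
  (λ xs (wl , split) → splitWithin⇒games (isWinLoss⇒exhausts m≥1 wl) split) ,
  length-games k m
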